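{- Let $M$ be an Event-B machine and $\varphi,\psi,\chi\in\mathcal{L}$ state formulae. (a) If $M\models\lozenge^{\neg\psi}\square\neg\chi$, the sentence $\mathrm{leadsto}(\chi\wedge\neg\psi,\chi\vee\psi)$ holds, and $M\models\square^{\neg\psi}(\varphi\wedge\neg\psi\rightarrow\chi)$, then $M\models\square(\varphi\rightarrow\lozenge\psi)$. (b) If $M\models\lozenge^{\neg\psi}\square\neg\chi$, $M\models\square^{\neg\psi}\,\mathrm{leadslocto}(\chi\wedge\neg\psi,\chi\vee\psi)$, and $M\models\square^{\neg\psi}(\varphi\wedge\neg\psi\rightarrow\chi)$, then $M\models\square(\varphi\rightarrow\lozenge\psi)$.
   Context: An Event-B machine $M$ has a tuple of state variables $\bar v=(v_0,\dots,v_m)$; a state $S$ assigns a value to each state variable. $\mathcal{L}$ denotes the set of first-order (set-theoretic) formulae whose free variables are among $\bar v$; they are evaluated in states. $M$ has an initialisation event determining the set of initial states, and a finite set $E$ of events $e_i$, each with a tuple of parameters $\bar x$, a guard $G_i(\bar x,\bar v)$ and a before-after predicate $P_{A_i}(\bar x,\bar v,\bar v')$. A state $S'$ is a successor of $S$ if for some $e_i\in E$ and parameter values $\bar x$, $G_i(\bar x,\bar v)$ holds in $S$ and $P_{A_i}(\bar x,\bar v,\bar v')$ holds with $\bar v$ the values in $S$ and $\bar v'$ those in $S'$. A state is deadlocked if no event is enabled in it. A trace of $M$ is a finite or infinite sequence $S_0,S_1,\dots$ with $S_0$ initial, each $S_{k+1}$ a successor of $S_k$, and, if finite, its last state deadlocked.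 $\mathrm{leadsto}(\varphi_1,\varphi_2)$ is the sentence $\bigwedge_{e_i\in E}\forall\bar v\,\bar x\,\bar v'\big(\varphi_1(\bar v)\wedge G_i(\bar x,\bar v)\wedge P_{A_i}(\bar x,\bar v,\bar v')\rightarrow\varphi_2(\bar v')\big)$ (over all states). $\mathrm{leadslocto}(\varphi_1,\varphi_2)$ is the state formula $\bigwedge_{e_i\in E}\forall\bar x\,\bar v'\big(\varphi_1(\bar v)\wedge G_i(\bar x,\bar v)\wedge P_{A_i}(\bar x,\bar v,\bar v')\rightarrow\varphi_2(\bar v')\big)$, true in a state $S$ iff, when $\varphi_1$ holds in $S$, $\varphi_2$ holds in every successor of $S$. A trace $S_0,S_1,\dots$ satisfies the selection condition $\langle\rho\rangle$ (for a state formula $\rho$) if there is an index $k$ of the trace such that $S_\ell\models\rho$ for all indices $\ell\ge k$ of the trace (for a finite trace: its last state satisfies $\rho$). Notation: $M\models\lozenge^{\rho}\square\theta$ means: for every trace of $M$ satisfying $\langle\rho\rangle$ there is an index $k$ with $S_\ell\models\theta$ for all indices $\ell\ge k$. $M\models\square^{\rho}\theta$ means: every state of every trace of $M$ satisfying $\langle\rho\rangle$ satisfies $\theta$. $M\models\square(\varphi\rightarrow\lozenge\psi)$ means: for every trace $S_0,S_1,\dots$ of $M$ and every index $i$ with $S_i\models\varphi$ there is an index $j\ge i$ with $S_j\models\psi$. -}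

module Defs where

open import Data.Nat using (ℕ; suc; _≤_)
open import Data.Fin using (Fin)
open import Data.Maybe using (Maybe; just; nothing)
open import Data.Unit using (⊤)
open import Data.Product using (Σ; ∃; _×_; _,_)
open import Data.Sum using (_⊎_)
open import Relation.Nullary using (¬_)
open import Relation.Binary.PropositionalEquality using (_≡_)

-- An Event-B machine, semantically: a type of states (valuations of the
-- state variables), a set of initial states, and finitely many events
-- (indexed by Fin nE), each with a parameter type, a guard G_i(x̄,v̄) and a
-- before-after predicate P_{A_i}(x̄,v̄,v̄').
record Machine : Set₁ where
  field
    State : Set
    Init  : State → Set
    nE    : ℕ
    Param : Fin nE → Set
    Guard : (i : Fin nE) → Param i → State → Set
    BA    : (i : Fin nE) → Param i → State → State → Set

-- State formulae are interpreted as predicates on states (wrapped in a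
-- record so that the machine can be inferred).
record StateFormula (M : Machine) : Set₁ where
  constructor ⟦_⟧
  field
    holds : Machine.State M → Set
open StateFormula public

module _ {M : Machine} where
  open Machine M

  ¬ₛ_ : StateFormula M → StateFormula M
  ¬ₛ φ = ⟦ (λ s → ¬ holds φ s) ⟧

  _∧ₛ_ : StateFormula M → StateFormula M → StateFormula M
  φ ∧ₛ ψ = ⟦ (λ s → holds φ s × holds ψ s) ⟧

  _∨ₛ_ : StateFormula M → StateFormula M → StateFormula M
  φ ∨ₛ ψ = ⟦ (λ s → holds φ s ⊎ holds ψ s) ⟧

  _⇒ₛ_ : StateFormula M → StateFormula M → StateFormula M
  φ ⇒ₛ ψ = ⟦ (λ s → holds φ s → holds ψ s) ⟧

  Successor : State → State → Set
  Successor s s' = Σ (Fin nE) λ i → Σ (Param i) λ x → Guard i x s × BA i x s s'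

  Deadlocked : State → Set
  Deadlocked s = ¬ (Σ (Fin nE) λ i → Σ (Param i) λ x → Guard i x s)

leadsto : (M : Machine) → StateFormula M → StateFormula M → Set
leadsto M φ₁ φ₂ = ∀ (i : Fin nE) (s : State) (x : Param i) (s' : State) →
  holds φ₁ s → Guard i x s → BA i x s s' → holds φ₂ s'
  where open Machine M

leadslocto : (M : Machine) → StateFormula M → StateFormula M → StateFormula M
leadslocto M φ₁ φ₂ = ⟦ (λ s → ∀ (i : Fin nE) (x : Param i) (s' : State) →
  holds φ₁ s → Guard i x s → BA i x s s' → holds φ₂ s') ⟧
  where open Machine M

-- Valid indices of a trace with given last index (nothing = infinite trace)
IsIndex : Maybe ℕ → ℕ → Set
IsIndex nothing  k = ⊤
IsIndex (just n) k = k ≤ n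

-- A (finite or infinite) trace S₀,S₁,…  Finite traces are encoded by their
-- last index n (lastIdx = just n); the values of seq beyond n are irrelevant.
record Trace (M : Machine) : Set where
  open Machine M
  field
    lastIdx : Maybe ℕ
    seq     : ℕ → State
    init    : Init (seq 0)
    step    : ∀ k → IsIndex lastIdx (suc k) → Successor {M} (seq k) (seq (suc k))
    final   : ∀ n → lastIdx ≡ just n → Deadlocked {M} (seq n)

module _ {M : Machine} where
  open Trace

  Index : Trace M → ℕ → Set
  Index τ k = IsIndex (lastIdx τ) k

  Selects : StateFormula M → Trace M → Set
  Selects ρ τ = Σ ℕ λ k → Index τ k × (∀ ℓ → k ≤ ℓ → Index τ ℓ → holds ρ (seq τ ℓ))

_⊨◇^_□_ : (M : Machine) → StateFormula M → StateFormula M → Set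
M ⊨◇^ ρ □ θ = ∀ (τ : Trace M) → Selects ρ τ →
  Σ ℕ λ k → Index τ k × (∀ ℓ → k ≤ ℓ → Index τ ℓ → holds θ (Trace.seq τ ℓ))

_⊨□^_∙_ : (M : Machine) → StateFormula M → StateFormula M → Set
M ⊨□^ ρ ∙ θ = ∀ (τ : Trace M) → Selects ρ τ →
  ∀ ℓ → Index τ ℓ → holds θ (Trace.seq τ ℓ)

_⊨□[_⇒◇_] : (M : Machine) → StateFormula M → StateFormula M → Set
M ⊨□[ φ ⇒◇ ψ ] = ∀ (τ : Trace M) (i : ℕ) → Index τ i → holds φ (Trace.seq τ i) →
  Σ ℕ λ j → i ≤ j × Index τ j × holds ψ (Trace.seq τ j)

-- If ψ were never reached after a φ-state, the trace would stay in ¬ψ from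
-- there on and so satisfy the selection condition ⟨¬ψ⟩. Then χ holds at that
-- state and every later step preserves it (the ψ-disjunct of χ ∨ ψ being
-- excluded), so χ holds forever; yet under ⟨¬ψ⟩ the trace eventually stays in
-- ¬χ. Excluded middle decides whether ψ is reached.
module Submission where

open import Defs
open import Data.Product using (_×_)
open import Axiom.ExcludedMiddle using (ExcludedMiddle)
open import Level using (0ℓ)

open import Data.Nat using (ℕ; suc; _≤_; _≤′_; ≤′-refl; ≤′-step)
open import Data.Nat.Properties using (≤-trans; ≤-refl; ≤-total; n≤1+n; ≤⇒≤′; ≤′⇒≤)
open import Data.Maybe using (Maybe; just; nothing)
open import Data.Product using (_,_)
open import Data.Sum using (inj₁; inj₂)
open import Data.Empty using (⊥; ⊥-elim)
open import Relation.Nullary using (¬_; yes; no)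

IsIndex-≤ : ∀ (last : Maybe ℕ) {a b} → a ≤ b → IsIndex last b → IsIndex last a
IsIndex-≤ nothing  _   _   = _
IsIndex-≤ (just n) a≤b b≤n = ≤-trans a≤b b≤n

module _ {M : Machine} (τ : Trace M) where
  open Machine M using (State)
  open Trace τ

  Index-≤ : ∀ {a b} → a ≤ b → Index τ b → Index τ a
  Index-≤ = IsIndex-≤ lastIdx

  AlwaysFrom : (State → Set) → ℕ → Set
  AlwaysFrom P k = ∀ ℓ → k ≤ ℓ → Index τ ℓ → P (seq ℓ)

  StepsPreserve : (State → Set) → (State → Set) → Set
  StepsPreserve P Q = ∀ ℓ → Index τ (suc ℓ) → P (seq ℓ) → Q (seq (suc ℓ))

  AlwaysFrom-induction : (P : State → Set) {i : ℕ} → P (seq i) →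
    (∀ ℓ → i ≤ ℓ → Index τ (suc ℓ) → P (seq ℓ) → P (seq (suc ℓ))) →
    AlwaysFrom P i
  AlwaysFrom-induction P {i} base step ℓ i≤ℓ = go (≤⇒≤′ i≤ℓ)
    where
    go : ∀ {ℓ} → i ≤′ ℓ → Index τ ℓ → P (seq ℓ)
    go ≤′-refl             _  = base
    go (≤′-step {ℓ} i≤′ℓ) iℓ =
      step ℓ (≤′⇒≤ i≤′ℓ) iℓ (go i≤′ℓ (Index-≤ (n≤1+n ℓ) iℓ))

  AlwaysFrom-contradiction : (P : State → Set) {i k : ℕ} → Index τ i → Index τ k →
    AlwaysFrom P i → AlwaysFrom (λ s → ¬ P s) k → ⊥
  AlwaysFrom-contradiction P {i} {k} ii ik p ¬p with ≤-total i k
  ... | inj₁ i≤k = ¬p k ≤-refl ik (p k i≤k ik)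
  ... | inj₂ k≤i = ¬p i k≤i ii (p i ≤-refl ii)

module _ {M : Machine} (φ₁ φ₂ : StateFormula M) (τ : Trace M) where
  open Trace τ

  leadsto⇒StepsPreserve : leadsto M φ₁ φ₂ → StepsPreserve τ (holds φ₁) (holds φ₂)
  leadsto⇒StepsPreserve lt ℓ iℓ φ₁ℓ with step ℓ iℓ
  ... | e , x , g , ba = lt e (seq ℓ) x (seq (suc ℓ)) φ₁ℓ g ba

  leadslocto⇒StepsPreserve : (∀ ℓ → Index τ ℓ → holds (leadslocto M φ₁ φ₂) (seq ℓ)) →
    StepsPreserve τ (holds φ₁) (holds φ₂)
  leadslocto⇒StepsPreserve llt ℓ iℓ φ₁ℓ with step ℓ iℓ
  ... | e , x , g , ba = llt ℓ (Index-≤ τ (n≤1+n ℓ) iℓ) e x (seq (suc ℓ)) φ₁ℓ g ba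

⊨□⇒◇-by-escaping-χ : ExcludedMiddle 0ℓ → (M : Machine) (φ ψ χ : StateFormula M) →
  (M ⊨◇^ (¬ₛ ψ) □ (¬ₛ χ)) →
  (∀ τ → Selects (¬ₛ ψ) τ → StepsPreserve τ (holds (χ ∧ₛ (¬ₛ ψ))) (holds (χ ∨ₛ ψ))) →
  (M ⊨□^ (¬ₛ ψ) ∙ ((φ ∧ₛ (¬ₛ ψ)) ⇒ₛ χ)) → M ⊨□[ φ ⇒◇ ψ ]
⊨□⇒◇-by-escaping-χ em M φ ψ χ eventually¬χ preserve φ⇒χ τ i ii φi with em
... | yes reached  = reached
... | no unreached =
  let k , ik , ¬χ-forever = eventually¬χ τ selects
  in ⊥-elim (AlwaysFrom-contradiction τ (holds χ) ii ik χ-forever ¬χ-forever)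
  where
  open Trace τ

  ¬ψ-forever : AlwaysFrom τ (holds (¬ₛ ψ)) i
  ¬ψ-forever ℓ i≤ℓ iℓ ψℓ = unreached (ℓ , i≤ℓ , iℓ , ψℓ)

  selects : Selects (¬ₛ ψ) τ
  selects = i , ii , ¬ψ-forever

  χ-step : ∀ ℓ → i ≤ ℓ → Index τ (suc ℓ) → holds χ (seq ℓ) → holds χ (seq (suc ℓ))
  χ-step ℓ i≤ℓ iℓ′ χℓ
    with preserve τ selects ℓ iℓ′ (χℓ , ¬ψ-forever ℓ i≤ℓ (Index-≤ τ (n≤1+n ℓ) iℓ′))
  ... | inj₁ χℓ′ = χℓ′
  ... | inj₂ ψℓ′ = ⊥-elim (¬ψ-forever (suc ℓ) (≤-trans i≤ℓ (n≤1+n ℓ)) iℓ′ ψℓ′)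

  χ-forever : AlwaysFrom τ (holds χ) i
  χ-forever = AlwaysFrom-induction τ (holds χ)
    (φ⇒χ τ selects i ii (φi , ¬ψ-forever i ≤-refl ii)) χ-step

lemma2p19 : ExcludedMiddle 0ℓ →
    (M : Machine) (φ ψ χ : StateFormula M) →
    ((M ⊨◇^ (¬ₛ ψ) □ (¬ₛ χ)) → leadsto M (χ ∧ₛ (¬ₛ ψ)) (χ ∨ₛ ψ) →
      (M ⊨□^ (¬ₛ ψ) ∙ ((φ ∧ₛ (¬ₛ ψ)) ⇒ₛ χ)) → M ⊨□[ φ ⇒◇ ψ ])
    × ((M ⊨◇^ (¬ₛ ψ) □ (¬ₛ χ)) → (M ⊨□^ (¬ₛ ψ) ∙ leadslocto M (χ ∧ₛ (¬ₛ ψ)) (χ ∨ₛ ψ)) →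
      (M ⊨□^ (¬ₛ ψ) ∙ ((φ ∧ₛ (¬ₛ ψ)) ⇒ₛ χ)) → M ⊨□[ φ ⇒◇ ψ ])
lemma2p19 em M φ ψ χ =
  (λ eventually¬χ lt φ⇒χ → ⊨□⇒◇-by-escaping-χ em M φ ψ χ eventually¬χ
     (λ τ _ → leadsto⇒StepsPreserve (χ ∧ₛ (¬ₛ ψ)) (χ ∨ₛ ψ) τ lt) φ⇒χ)
  , (λ eventually¬χ llt φ⇒χ → ⊨□⇒◇-by-escaping-χ em M φ ψ χ eventually¬χ
     (λ τ selects → leadslocto⇒StepsPreserve (χ ∧ₛ (¬ₛ ψ)) (χ ∨ₛ ψ) τ (llt τ selects)) φ⇒χ)
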